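{- Let $G$ be a connected graph of order $n\ge 3$ and let $H$ be a non-trivial graph. The following are equivalent: (i) no adjacency basis for $H$ is a dominating set of $H$; (ii) $\operatorname{dim}_A(G\odot H)=n\cdot \operatorname{dim}_A(H)+n-1$; (iii) $\operatorname{dim}_A(G\odot H)=\operatorname{dim}(G\odot H)+n-1$.
   Context: All graphs are finite, simple, undirected; non-trivial means order at least 2. For a connected graph, $d$ is shortest-path distance; a metric generator is a vertex set $S$ such that every two distinct vertices $x,y$ satisfy $d(s,x)\ne d(s,y)$ for some $s\in S$; $\operatorname{dim}$ is the minimum size of a metric generator. A set $S\subseteq V(H)$ is an adjacency generator for $H$ if for every two distinct $x,y\in V(H)\setminus S$ there exists $s\in S$ with $|N_H(s)\cap\{x,y\}|=1$ ($N_H$ the open neighbourhood); an adjacency basis is an adjacency generator of minimum cardinality, and this cardinality is $\operatorname{dim}_A(H)$. A dominating set $D$ satisfies $\bigcup_{v\in D}N_H[v]=V(H)$. The corona product $G\odot H$ ($G$ of order $n$ with vertices $v_1,\dots,v_n$) consists of $G$ and $n$ disjoint copies $H_1,\dots,H_n$ of $H$, with $v_i$ joined to every vertex of $H_i$. -}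

module Defs where

open import Data.Nat using (ℕ; zero; suc; _+_; _*_; _≤_; _<_)
open import Data.Fin using (Fin; zero; suc; remQuot; _≟_)
open import Data.Fin.Subset using (Subset; _∈_; _∉_; ∣_∣)
open import Data.Bool using (Bool; true; false; _∧_)
open import Data.Product using (Σ; ∃; _×_; _,_)
open import Data.Sum using (_⊎_)
open import Relation.Nullary using (¬_)
open import Relation.Nullary.Decidable using (⌊_⌋)
open import Relation.Binary.PropositionalEquality using (_≡_; _≢_)

Graph : ℕ → Set
Graph n = Fin n → Fin n → Bool

Adj : ∀ {n} → Graph n → Fin n → Fin n → Set
Adj G x y = G x y ≡ true

IsSimple : ∀ {n} → Graph n → Set
IsSimple {n} G = (∀ (x y : Fin n) → G x y ≡ G y x) × (∀ (x : Fin n) → G x x ≡ false)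

data Walk {n} (G : Graph n) : Fin n → Fin n → ℕ → Set where
  here : ∀ x → Walk G x x 0
  step : ∀ {x y z k} → Adj G x y → Walk G y z k → Walk G x z (suc k)

Connected : ∀ {n} → Graph n → Set
Connected {n} G = ∀ (x y : Fin n) → ∃ λ k → Walk G x y k

IsDist : ∀ {n} → Graph n → Fin n → Fin n → ℕ → Set
IsDist G x y k = Walk G x y k × (∀ m → m < k → ¬ Walk G x y m)

IsMetricGenerator : ∀ {n} → Graph n → Subset n → Set
IsMetricGenerator {n} G S = ∀ (x y : Fin n) → x ≢ y →
  Σ (Fin n) λ s → s ∈ S × Σ ℕ λ k₁ → Σ ℕ λ k₂ →
    IsDist G s x k₁ × IsDist G s y k₂ × k₁ ≢ k₂

IsMetricDim : ∀ {n} → Graph n → ℕ → Set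
IsMetricDim {n} G k = (Σ (Subset n) λ S → IsMetricGenerator G S × ∣ S ∣ ≡ k)
  × (∀ (S : Subset n) → IsMetricGenerator G S → k ≤ ∣ S ∣)

Distinguishes : ∀ {n} → Graph n → Fin n → Fin n → Fin n → Set
Distinguishes G s x y = (Adj G s x × ¬ Adj G s y) ⊎ (¬ Adj G s x × Adj G s y)

IsAdjGenerator : ∀ {n} → Graph n → Subset n → Set
IsAdjGenerator {n} G S = ∀ (x y : Fin n) → x ≢ y → x ∉ S → y ∉ S →
  Σ (Fin n) λ s → s ∈ S × Distinguishes G s x y

IsAdjBasis : ∀ {n} → Graph n → Subset n → Set
IsAdjBasis {n} G S = IsAdjGenerator G S × (∀ (T : Subset n) → IsAdjGenerator G T → ∣ S ∣ ≤ ∣ T ∣)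

IsAdjDim : ∀ {n} → Graph n → ℕ → Set
IsAdjDim {n} G k = (Σ (Subset n) λ S → IsAdjGenerator G S × ∣ S ∣ ≡ k)
  × (∀ (S : Subset n) → IsAdjGenerator G S → k ≤ ∣ S ∣)

IsDominating : ∀ {n} → Graph n → Subset n → Set
IsDominating {n} G D = ∀ (v : Fin n) → v ∈ D ⊎ Σ (Fin n) λ u → u ∈ D × Adj G u v

-- Corona product G ⊙ H. Vertex set Fin (n * suc h); via remQuot a vertex is a pair (i , j)
-- with i : Fin n, j : Fin (suc h); (i , zero) is v_i of G and (i , suc a) is vertex a of the copy H_i.
coronaAdj : ∀ {n h} → Graph n → Graph h → Fin n × Fin (suc h) → Fin n × Fin (suc h) → Bool
coronaAdj G H (i , zero)  (i' , zero)   = G i i'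
coronaAdj G H (i , zero)  (i' , suc b)  = ⌊ i ≟ i' ⌋
coronaAdj G H (i , suc a) (i' , zero)   = ⌊ i ≟ i' ⌋
coronaAdj G H (i , suc a) (i' , suc b)  = ⌊ i ≟ i' ⌋ ∧ H a b

_⊙_ : ∀ {n h} → Graph n → Graph h → Graph (n * suc h)
_⊙_ {n} {h} G H x y = coronaAdj G H (remQuot (suc h) x) (remQuot (suc h) y)

-- A vertex outside the i-th block {v_i} ∪ H_i reaches H_i only through v_i, so it sees all of
-- H_i alike; hence the trace on H_i of any metric or adjacency generator of G ⊙ H is an
-- adjacency generator of H. Conversely a (nonempty) adjacency basis B of H copied into every
-- H_i is a metric generator, so dim(G ⊙ H) = n · dim_A(H). Adjacency generators additionally
-- need hubs: B in every copy together with all hubs but one always works. If no adjacency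
-- basis dominates H, a block carrying only dim_A(H) vertices has no hub and leaves a vertex of
-- its copy with no neighbour in the generator; two such blocks would leave two vertices that
-- nothing separates, so all blocks but one carry at least dim_A(H) + 1 vertices. If a basis B
-- dominates H, neighbours in B already separate the copies from each other, and the hubs of
-- two neighbours of a common vertex of G (which exist since G is connected of order ≥ 3) can
-- both be dropped.

module Submission where

open import Defs
open import Data.Nat using (ℕ; zero; suc; _+_; _*_; _∸_; _≤_; _<_; z≤n; s≤s)
open import Data.Nat.Properties
open import Data.Fin as Fin using (Fin; combine; remQuot; _↑ˡ_; _↑ʳ_)
open import Data.Fin.Subset using (Subset; _∈_; _∉_; ∣_∣; Nonempty; ⊥; ∁; ⁅_⁆; _-_)
open import Data.Fin.Subset.Properties using (_∈?_; ∣⊥∣≡0; ∣⁅x⁆∣≡1; ∣∁p∣≡n∸∣p∣; x∈p⇒∣p-x∣<∣p∣; x∉p⇒x∈∁p; x∉∁p⇒x∈p; x≢y⇒x∉⁅y⁆; x∈⁅y⁆⇒x≡y; x∈p∧x≢y⇒x∈p-y)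
import Data.Fin.Properties as Finₚ
open Finₚ using (any?; ¬∀⟶∃¬; remQuot-combine; combine-remQuot)
open import Data.Bool as Bool using (Bool; true; false; _∧_)
open import Data.Bool.Properties using (not-¬)
open import Data.Vec using ([]; _∷_; lookup; tabulate)
open import Data.Vec.Properties using ([]=⇒lookup; lookup⇒[]=; lookup∘tabulate; tabulate∘lookup; tabulate-cong)
open import Data.Product using (Σ; ∃; _×_; _,_; proj₁; proj₂)
open import Function using (_∘_)
open import Relation.Binary.Definitions using (tri<; tri≈; tri>)
open import Data.Sum using (_⊎_; inj₁; inj₂; [_,_]′)
open import Relation.Nullary using (¬_; Dec; yes; no; contradiction)
open import Relation.Nullary.Decidable using (⌊_⌋; ¬?; _×-dec_; _⊎-dec_; isYes≗does; dec-true; dec-false)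
open import Relation.Binary.PropositionalEquality
open import Function.Bundles using (_⇔_; mk⇔; Equivalence)
open import Algebra.Properties.CommutativeMonoid.Sum +-0-commutativeMonoid
  using (sum; sum-syntax; sum-cong-≗; ∑-distrib-+)

∑-const : ∀ m c → ∑[ i < m ] c ≡ m * c
∑-const zero    c = refl
∑-const (suc m) c = cong (c +_) (∑-const m c)

∑-mono-≤ : ∀ {m} {f g : Fin m → ℕ} → (∀ i → f i ≤ g i) → sum f ≤ sum g
∑-mono-≤ {zero}  f≤g = z≤n
∑-mono-≤ {suc m} f≤g = +-mono-≤ (f≤g Fin.zero) (∑-mono-≤ (λ i → f≤g (Fin.suc i)))

∑-splitAt : ∀ m k (f : Fin (m + k) → ℕ) → sum f ≡ ∑[ i < m ] f (i ↑ˡ k) + ∑[ j < k ] f (m ↑ʳ j)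
∑-splitAt zero    k f = refl
∑-splitAt (suc m) k f = trans (cong (f Fin.zero +_) (∑-splitAt m k (λ i → f (Fin.suc i))))
                              (sym (+-assoc (f Fin.zero) _ _))

∑-combine : ∀ m k (f : Fin (m * k) → ℕ) → sum f ≡ ∑[ i < m ] ∑[ j < k ] f (combine i j)
∑-combine zero    k f = refl
∑-combine (suc m) k f = trans (∑-splitAt k (m * k) f)
                              (cong (∑[ j < k ] f (j ↑ˡ (m * k)) +_) (∑-combine m k (λ x → f (k ↑ʳ x))))

∑-≥-all-but-one : ∀ {m} a (f : Fin m → ℕ) → (∀ i → a ≤ f i) →
                  (∀ i j → f i ≤ a → f j ≤ a → i ≡ j) → m * a + (m ∸ 1) ≤ sum f
∑-≥-all-but-one {zero}  a f a≤f small-unique = z≤n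
∑-≥-all-but-one {suc m} a f a≤f small-unique with f Fin.zero ≤? a
... | yes f₀≤a = begin
  a + m * a + m        ≡⟨ +-assoc a (m * a) m ⟩
  a + (m * a + m)      ≡⟨ cong (a +_) (trans (+-comm (m * a) m) (sym (*-suc m a))) ⟩
  a + m * suc a        ≡⟨ cong (a +_) (∑-const m (suc a)) ⟨
  a + ∑[ i < m ] suc a ≤⟨ +-mono-≤ (a≤f Fin.zero) (∑-mono-≤ rest-large) ⟩
  sum f                ∎
  where
  open ≤-Reasoning
  rest-large : ∀ i → suc a ≤ f (Fin.suc i)
  rest-large i with f (Fin.suc i) ≤? a
  ... | yes fᵢ≤a = contradiction (small-unique Fin.zero (Fin.suc i) f₀≤a fᵢ≤a) λ ()
  ... | no  fᵢ≰a = ≰⇒> fᵢ≰a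
... | no f₀≰a = begin
  a + m * a + m                    ≡⟨ +-assoc a (m * a) m ⟩
  a + (m * a + m)                  ≤⟨ +-monoʳ-≤ a (+-monoʳ-≤ (m * a) (m≤n+m∸n m 1)) ⟩
  a + (m * a + suc (m ∸ 1))        ≡⟨ cong (a +_) (+-suc (m * a) (m ∸ 1)) ⟩
  a + suc (m * a + (m ∸ 1))        ≡⟨ +-suc a _ ⟩
  suc a + (m * a + (m ∸ 1))        ≤⟨ +-mono-≤ (≰⇒> f₀≰a) tail-bound ⟩
  sum f                            ∎
  where
  open ≤-Reasoning
  tail-bound : m * a + (m ∸ 1) ≤ ∑[ i < m ] f (Fin.suc i)
  tail-bound = ∑-≥-all-but-one a (λ i → f (Fin.suc i)) (λ i → a≤f (Fin.suc i))
                 (λ i j p q → Finₚ.suc-injective (small-unique (Fin.suc i) (Fin.suc j) p q))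

indicator : Bool → ℕ
indicator true  = 1
indicator false = 0

∣p∣≡∑ : ∀ {m} (p : Subset m) → ∣ p ∣ ≡ ∑[ i < m ] indicator (lookup p i)
∣p∣≡∑ []          = refl
∣p∣≡∑ (true ∷ p)  = cong suc (∣p∣≡∑ p)
∣p∣≡∑ (false ∷ p) = ∣p∣≡∑ p

∣∁⁅x⁆∣≡n∸1 : ∀ {m} (x : Fin m) → ∣ ∁ ⁅ x ⁆ ∣ ≡ m ∸ 1
∣∁⁅x⁆∣≡n∸1 {m} x = trans (∣∁p∣≡n∸∣p∣ ⁅ x ⁆) (cong (m ∸_) (∣⁅x⁆∣≡1 x))

∈∧∉⇒≢ : ∀ {m} {p : Subset m} {x y} → x ∈ p → y ∉ p → x ≢ y
∈∧∉⇒≢ x∈p y∉p refl = y∉p x∈p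

x∈p⇒indicator≡1 : ∀ {m} {x : Fin m} {p : Subset m} → x ∈ p → indicator (lookup p x) ≡ 1
x∈p⇒indicator≡1 x∈p = cong indicator ([]=⇒lookup x∈p)

module Walks {N} (K : Graph N) where

  walk₀⇒≡ : ∀ {x y} → Walk K x y 0 → x ≡ y
  walk₀⇒≡ (here _) = refl

  walk₁⇒adj : ∀ {x y} → Walk K x y 1 → Adj K x y
  walk₁⇒adj (step xy (here _)) = xy

  walk-length-positive : ∀ {x y k} → x ≢ y → Walk K x y k → 0 < k
  walk-length-positive x≢y (here _)   = contradiction refl x≢y
  walk-length-positive _   (step _ _) = s≤s z≤n

  _▻_ : ∀ {x y z k} → Walk K x y k → Adj K y z → Walk K x z (suc k)
  here _     ▻ yz = step yz (here _)
  step xy w ▻ yz = step xy (w ▻ yz)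

  walk? : ∀ x y k → Dec (Walk K x y k)
  walk? x y zero with x Fin.≟ y
  ... | yes refl = yes (here x)
  ... | no  x≢y  = no λ w → x≢y (walk₀⇒≡ w)
  walk? x y (suc k) with any? (λ z → (K x z Bool.≟ true) ×-dec walk? z y k)
  ... | yes (z , xz , w) = yes (step xz w)
  ... | no  ¬step        = no λ { (step {y = z} xz w) → ¬step (z , xz , w) }

  no-walk-below-or-IsDist : ∀ x y m → (∀ j → j < m → ¬ Walk K x y j) ⊎ ∃ (IsDist K x y)
  no-walk-below-or-IsDist x y zero = inj₁ λ _ ()
  no-walk-below-or-IsDist x y (suc m) with no-walk-below-or-IsDist x y m
  ... | inj₂ d    = inj₂ d
  ... | inj₁ none with walk? x y m
  ...   | yes w = inj₂ (m , w , none)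
  ...   | no ¬w = inj₁ λ j j<1+m → [ none j , (λ { refl → ¬w }) ]′ (m<1+n⇒m<n∨m≡n j<1+m)

  walk⇒IsDist : ∀ {x y k} → Walk K x y k → ∃ (IsDist K x y)
  walk⇒IsDist {x} {y} {k} w with no-walk-below-or-IsDist x y (suc k)
  ... | inj₁ none = contradiction w (none k (n<1+n k))
  ... | inj₂ d    = d

  IsDist-unique : ∀ {x y d e} → IsDist K x y d → IsDist K x y e → d ≡ e
  IsDist-unique {d = d} {e} (wd , min-d) (we , min-e) with <-cmp d e
  ... | tri< d<e _ _ = contradiction wd (min-e d d<e)
  ... | tri≈ _ d≡e _ = d≡e
  ... | tri> _ _ e<d = contradiction we (min-d e e<d)

module Distance {N} (K : Graph N) (connected : Connected K) where
  open Walks K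

  dist : Fin N → Fin N → ℕ
  dist x y = proj₁ (walk⇒IsDist (proj₂ (connected x y)))

  dist-IsDist : ∀ x y → IsDist K x y (dist x y)
  dist-IsDist x y = proj₂ (walk⇒IsDist (proj₂ (connected x y)))

  IsDist⇒≡dist : ∀ {x y d} → IsDist K x y d → d ≡ dist x y
  IsDist⇒≡dist d = IsDist-unique d (dist-IsDist _ _)

  dist-≤ : ∀ {x y k} → Walk K x y k → dist x y ≤ k
  dist-≤ {x} {y} w = ≮⇒≥ λ k<d → proj₂ (dist-IsDist x y) _ k<d w

  dist-refl : ∀ x → dist x x ≡ 0
  dist-refl x = n≤0⇒n≡0 (dist-≤ (here x))

  dist≡0⇒≡ : ∀ {x y} → dist x y ≡ 0 → x ≡ y
  dist≡0⇒≡ {x} {y} d≡0 = walk₀⇒≡ (subst (Walk K x y) d≡0 (proj₁ (dist-IsDist x y)))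

  dist≡1⇒adj : ∀ {x y} → dist x y ≡ 1 → Adj K x y
  dist≡1⇒adj {x} {y} d≡1 = walk₁⇒adj (subst (Walk K x y) d≡1 (proj₁ (dist-IsDist x y)))

  dist-adj : ∀ {x y} → x ≢ y → Adj K x y → dist x y ≡ 1
  dist-adj x≢y xy = ≤-antisym (dist-≤ (step xy (here _))) (n≢0⇒n>0 (x≢y ∘ dist≡0⇒≡))

  2≤dist : ∀ {x y} → x ≢ y → ¬ Adj K x y → 2 ≤ dist x y
  2≤dist {x} {y} x≢y ¬xy with dist x y in d≡
  ... | zero        = contradiction (dist≡0⇒≡ d≡) x≢y
  ... | suc zero    = contradiction (dist≡1⇒adj d≡) ¬xy
  ... | suc (suc _) = s≤s (s≤s z≤n)

Adj⇒≢ : ∀ {n} {G : Graph n} {x y} → IsSimple G → Adj G x y → x ≢ y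
Adj⇒≢ (_ , loopless) xy refl with () ← trans (sym (loopless _)) xy

other-vertex : ∀ {n} → 2 ≤ n → (i : Fin n) → ∃ λ j → j ≢ i
other-vertex (s≤s (s≤s _)) Fin.zero    = Fin.suc Fin.zero , λ ()
other-vertex (s≤s (s≤s _)) (Fin.suc _) = Fin.zero , λ ()

record Cherry {n} (G : Graph n) : Set where
  field
    centre leaf₁ leaf₂ : Fin n
    leaf₁≢leaf₂        : leaf₁ ≢ leaf₂
    centre-leaf₁       : Adj G centre leaf₁
    centre-leaf₂       : Adj G centre leaf₂

-- If every vertex had at most one neighbour, the walks from 0 could never leave {0, p}
-- for the neighbour p of 0, so a third vertex would be unreachable.
cherry : ∀ {n} (G : Graph n) → IsSimple G → Connected G → 3 ≤ n → Cherry G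
cherry G (G-sym , _) connected (s≤s (s≤s (s≤s _)))
  with any? (λ w → any? λ u₁ → any? λ u₂ →
         ¬? (u₁ Fin.≟ u₂) ×-dec (G w u₁ Bool.≟ true) ×-dec (G w u₂ Bool.≟ true))
... | yes (w , u₁ , u₂ , u₁≢u₂ , wu₁ , wu₂) = record
  { centre = w ; leaf₁ = u₁ ; leaf₂ = u₂ ; leaf₁≢leaf₂ = u₁≢u₂ ; centre-leaf₁ = wu₁ ; centre-leaf₂ = wu₂ }
... | no ¬cherry = contradiction outsider λ (z , z≢v₀ , z≢p) → [ z≢v₀ , z≢p ]′ (trapped z)
  where
  v₀ v₁ v₂ : Fin _
  v₀ = Fin.zero
  v₁ = Fin.suc Fin.zero
  v₂ = Fin.suc (Fin.suc Fin.zero)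

  neighbour-unique : ∀ {w u v} → Adj G w u → Adj G w v → u ≡ v
  neighbour-unique {w} {u} {v} wu wv with u Fin.≟ v
  ... | yes u≡v = u≡v
  ... | no  u≢v = contradiction (w , u , v , u≢v , wu , wv) ¬cherry

  first-neighbour : ∀ {x y k} → x ≢ y → Walk G x y k → ∃ (Adj G x)
  first-neighbour x≢y (here _)             = contradiction refl x≢y
  first-neighbour _   (step {y = z} xz _) = z , xz

  p : Fin _
  p = proj₁ (first-neighbour (λ ()) (proj₂ (connected v₀ v₁)))

  v₀p : Adj G v₀ p
  v₀p = proj₂ (first-neighbour (λ ()) (proj₂ (connected v₀ v₁)))

  stays : ∀ {y z k} → Walk G y z k → y ≡ v₀ ⊎ y ≡ p → z ≡ v₀ ⊎ z ≡ p
  stays (here _)     y∈          = y∈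
  stays (step yy′ w) (inj₁ refl) = stays w (inj₂ (neighbour-unique yy′ v₀p))
  stays (step yy′ w) (inj₂ refl) = stays w (inj₁ (neighbour-unique yy′ (trans (G-sym p v₀) v₀p)))

  trapped : ∀ z → z ≡ v₀ ⊎ z ≡ p
  trapped z = stays (proj₂ (connected v₀ z)) (inj₁ refl)

  outsider : ∃ λ z → z ≢ v₀ × z ≢ p
  outsider with p Fin.≟ v₁
  ... | yes p≡v₁ = v₂ , (λ ()) , λ v₂≡p → contradiction (trans v₂≡p p≡v₁) λ ()
  ... | no  p≢v₁ = v₁ , (λ ()) , p≢v₁ ∘ sym

distinguishes⇔≢ : ∀ {n} {G : Graph n} {s x y} → Distinguishes G s x y ⇔ (G s x ≢ G s y)
distinguishes⇔≢ {G = G} {s} {x} {y} = mk⇔ to from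
  where
  to : Distinguishes G s x y → G s x ≢ G s y
  to (inj₁ (sx , ¬sy)) sx≡sy = ¬sy (trans (sym sx≡sy) sx)
  to (inj₂ (¬sx , sy)) sx≡sy = ¬sx (trans sx≡sy sy)
  from : G s x ≢ G s y → Distinguishes G s x y
  from sx≢sy with G s x | G s y
  ... | true  | true  = contradiction refl sx≢sy
  ... | true  | false = inj₁ (refl , λ ())
  ... | false | true  = inj₂ ((λ ()) , refl)
  ... | false | false = contradiction refl sx≢sy

distinguishes-sym : ∀ {n} {G : Graph n} {s x y} → Distinguishes G s x y → Distinguishes G s y x
distinguishes-sym (inj₁ (sx , ¬sy)) = inj₂ (¬sy , sx)
distinguishes-sym (inj₂ (¬sx , sy)) = inj₁ (sy , ¬sx)

distinguishes⇒adj : ∀ {n} {G : Graph n} {s x y} → Distinguishes G s x y → Adj G s x ⊎ Adj G s y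
distinguishes⇒adj (inj₁ (sx , _)) = inj₁ sx
distinguishes⇒adj (inj₂ (_ , sy)) = inj₂ sy

adjacency-generator-nonempty : ∀ {h} {H : Graph h} {S} → 2 ≤ h → IsAdjGenerator H S → Nonempty S
adjacency-generator-nonempty {S = S} (s≤s (s≤s _)) generates
  with Fin.zero ∈? S | Fin.suc Fin.zero ∈? S
... | yes 0∈S | _       = _ , 0∈S
... | no _    | yes 1∈S = _ , 1∈S
... | no 0∉S  | no 1∉S  with generates Fin.zero (Fin.suc Fin.zero) (λ ()) 0∉S 1∉S
...   | s , s∈S , _ = s , s∈S

undominated-vertex : ∀ {h} {H : Graph h} {S} → ¬ IsDominating H S →
                     ∃ λ u → u ∉ S × (∀ c → c ∈ S → ¬ Adj H c u)
undominated-vertex {h} {H} {S} ¬dominating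
  with ¬∀⟶∃¬ h _ (λ u → (u ∈? S) ⊎-dec any? (λ c → (c ∈? S) ×-dec (H c u Bool.≟ true))) ¬dominating
... | u , ¬dominated = u , ¬dominated ∘ inj₁ , λ c c∈S cu → ¬dominated (inj₂ (c , c∈S , cu))

HasDominatingAdjBasis : ∀ {h} → Graph h → Set
HasDominatingAdjBasis {h} H = Σ (Subset h) λ S → IsAdjBasis H S × IsDominating H S

adj-basis-size : ∀ {h} {H : Graph h} {a S} → IsAdjDim H a → IsAdjBasis H S → ∣ S ∣ ≡ a
adj-basis-size ((B , B-generates , ∣B∣≡a) , minimal) (S-generates , S-minimal) =
  ≤-antisym (≤-trans (S-minimal B B-generates) (≤-reflexive ∣B∣≡a)) (minimal _ S-generates)

small-adj-generator-is-basis : ∀ {h} {H : Graph h} {a S} → IsAdjDim H a →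
                               IsAdjGenerator H S → ∣ S ∣ ≤ a → IsAdjBasis H S
small-adj-generator-is-basis (_ , minimal) S-generates ∣S∣≤a =
  S-generates , λ T T-generates → ≤-trans ∣S∣≤a (minimal T T-generates)

module Corona {n h} (G : Graph n) (H : Graph h) (G-simple : IsSimple G) (G-connected : Connected G) where

  hub : Fin n → Fin (n * suc h)
  hub i = combine i Fin.zero

  copy : Fin n → Fin h → Fin (n * suc h)
  copy i c = combine i (Fin.suc c)

  block : Fin (n * suc h) → Fin n
  block x = proj₁ (remQuot (suc h) x)

  block-combine : ∀ i j → block (combine i j) ≡ i
  block-combine i j = cong proj₁ (remQuot-combine i j)

  copy-injective : ∀ {i a b} → copy i a ≡ copy i b → a ≡ b
  copy-injective {i} eq = Finₚ.suc-injective (Finₚ.combine-injectiveʳ i _ i _ eq)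

  copy≢hub : ∀ {i i′ c} → copy i c ≢ hub i′
  copy≢hub {i} {i′} eq with () ← Finₚ.combine-injectiveʳ i _ i′ _ eq

  outside-block-≢ : ∀ {i c y} → block y ≢ i → copy i c ≢ y
  outside-block-≢ {i} {c} y∉i refl = y∉i (block-combine i (Fin.suc c))

  data View : Fin (n * suc h) → Set where
    hubᵛ  : ∀ i → View (hub i)
    copyᵛ : ∀ i c → View (copy i c)

  view : ∀ x → View x
  view x = subst View (combine-remQuot {n} (suc h) x) (view-pair (remQuot (suc h) x))
    where
    view-pair : ∀ p → View (combine (proj₁ p) (proj₂ p))
    view-pair (i , Fin.zero)  = hubᵛ i
    view-pair (i , Fin.suc c) = copyᵛ i c

  block-members : ∀ {i s} → block s ≡ i → s ≡ hub i ⊎ ∃ λ c → s ≡ copy i c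
  block-members {i} {s} s∈i with view s
  ... | hubᵛ i′    with refl ← trans (sym (block-combine i′ Fin.zero)) s∈i = inj₁ refl
  ... | copyᵛ i′ c with refl ← trans (sym (block-combine i′ (Fin.suc c))) s∈i = inj₂ (c , refl)

  K : Graph (n * suc h)
  K = G ⊙ H

  private
    ⌊≟⌋-true : ∀ (i : Fin n) → ⌊ i Fin.≟ i ⌋ ≡ true
    ⌊≟⌋-true i = trans (isYes≗does (i Fin.≟ i)) (dec-true (i Fin.≟ i) refl)

    ⌊≟⌋-false : ∀ {i i′ : Fin n} → i ≢ i′ → ⌊ i Fin.≟ i′ ⌋ ≡ false
    ⌊≟⌋-false {i} {i′} i≢i′ = trans (isYes≗does (i Fin.≟ i′)) (dec-false (i Fin.≟ i′) i≢i′)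

  ⊙-combine : ∀ i j i′ j′ → K (combine i j) (combine i′ j′) ≡ coronaAdj G H (i , j) (i′ , j′)
  ⊙-combine i j i′ j′ rewrite remQuot-combine {n} {suc h} i j | remQuot-combine {n} {suc h} i′ j′ = refl

  hub-hub : ∀ i i′ → K (hub i) (hub i′) ≡ G i i′
  hub-hub i i′ = ⊙-combine i Fin.zero i′ Fin.zero

  copy-copy : ∀ i a b → K (copy i a) (copy i b) ≡ H a b
  copy-copy i a b = trans (⊙-combine i (Fin.suc a) i (Fin.suc b)) (cong (_∧ H a b) (⌊≟⌋-true i))

  hub-copy : ∀ i c → Adj K (hub i) (copy i c)
  hub-copy i c = trans (⊙-combine i Fin.zero i (Fin.suc c)) (⌊≟⌋-true i)

  copy-hub : ∀ i c → Adj K (copy i c) (hub i)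
  copy-hub i c = trans (⊙-combine i (Fin.suc c) i Fin.zero) (⌊≟⌋-true i)

  hub-¬adj-other-copy : ∀ {i i′} c → i ≢ i′ → ¬ Adj K (hub i) (copy i′ c)
  hub-¬adj-other-copy {i} {i′} c i≢i′ = not-¬ (trans (⊙-combine i Fin.zero i′ (Fin.suc c)) (⌊≟⌋-false i≢i′))

  block-≢ : ∀ {i i′} j → block (combine i′ j) ≢ i → i ≢ i′
  block-≢ j y∉i i≡i′ = y∉i (trans (block-combine _ j) (sym i≡i′))

  ≢-block : ∀ {i i′} j → i ≢ i′ → block (combine i j) ≢ i′
  ≢-block {i} j i≢i′ eq = i≢i′ (trans (sym (block-combine i j)) eq)

  copy-¬adj-outside : ∀ {i y} c → block y ≢ i → ¬ Adj K (copy i c) y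
  copy-¬adj-outside {i} {y} c y∉i with view y
  ... | hubᵛ i′    = not-¬ (trans (⊙-combine i (Fin.suc c) i′ Fin.zero) (⌊≟⌋-false (block-≢ Fin.zero y∉i)))
  ... | copyᵛ i′ b = not-¬ (trans (⊙-combine i (Fin.suc c) i′ (Fin.suc b))
                                  (cong (_∧ H c b) (⌊≟⌋-false (block-≢ (Fin.suc b) y∉i))))

  outside-¬adj-copy : ∀ {i s} c → block s ≢ i → ¬ Adj K s (copy i c)
  outside-¬adj-copy {i} {s} c s∉i with view s
  ... | hubᵛ i′    = hub-¬adj-other-copy c (block-≢ Fin.zero s∉i ∘ sym)
  ... | copyᵛ i′ d = copy-¬adj-outside d (≢-block (Fin.suc c) (block-≢ (Fin.suc d) s∉i))

  open Walks K

  enter-block-at-hub : ∀ {i s t} → Adj K s t → block s ≢ i → block t ≡ i → t ≡ hub i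
  enter-block-at-hub st s∉i t∈i with block-members t∈i
  ... | inj₁ t≡hub      = t≡hub
  ... | inj₂ (c , refl) = contradiction st (outside-¬adj-copy c s∉i)

  walk-enters-via-hub : ∀ {i s k} b → block s ≢ i → Walk K s (copy i b) k →
                        ∃ λ k′ → k′ < k × Walk K s (hub i) k′
  walk-enters-via-hub {i} b s∉i (here _) = contradiction (block-combine i _) s∉i
  walk-enters-via-hub {i} b s∉i (step {y = t} st w) with block t Fin.≟ i
  ... | yes t∈i with refl ← enter-block-at-hub st s∉i t∈i =
    1 , s≤s (walk-length-positive (copy≢hub ∘ sym) w) , step st (here _)
  ... | no  t∉i with walk-enters-via-hub b t∉i w
  ...   | k′ , k′<k , w′ = suc k′ , s≤s k′<k , step st w′

  lift-walk : ∀ {i i′ k} → Walk G i i′ k → Walk K (hub i) (hub i′) k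
  lift-walk (here _)   = here _
  lift-walk (step ii′ w) = step (trans (hub-hub _ _) ii′) (lift-walk w)

  hubs-connected : ∀ i i′ → ∃ (Walk K (hub i) (hub i′))
  hubs-connected i i′ = _ , lift-walk (proj₂ (G-connected i i′))

  ⊙-connected : Connected K
  ⊙-connected x y with view x | view y
  ... | hubᵛ i    | hubᵛ i′    = hubs-connected i i′
  ... | hubᵛ i    | copyᵛ i′ c = _ , proj₂ (hubs-connected i i′) ▻ hub-copy i′ c
  ... | copyᵛ i c | hubᵛ i′    = _ , step (copy-hub i c) (proj₂ (hubs-connected i i′))
  ... | copyᵛ i c | copyᵛ i′ d = _ , step (copy-hub i c) (proj₂ (hubs-connected i i′) ▻ hub-copy i′ d)

  open Distance K ⊙-connected public

  dist-via-hub : ∀ {i s} b → block s ≢ i → dist s (copy i b) ≡ suc (dist s (hub i))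
  dist-via-hub {i} {s} b s∉i with walk-enters-via-hub b s∉i (proj₁ (dist-IsDist s (copy i b)))
  ... | k′ , k′<d , w′ = ≤-antisym (dist-≤ (proj₁ (dist-IsDist s (hub i)) ▻ hub-copy i b))
                                   (≤-trans (s≤s (dist-≤ w′)) k′<d)

  dist-copy-hub : ∀ i c → dist (copy i c) (hub i) ≡ 1
  dist-copy-hub i c = dist-adj copy≢hub (copy-hub i c)

  dist-hub-copy : ∀ i c → dist (hub i) (copy i c) ≡ 1
  dist-hub-copy i c = dist-adj (copy≢hub ∘ sym) (hub-copy i c)

  dist-within-copy-≤2 : ∀ i c a → dist (copy i c) (copy i a) ≤ 2
  dist-within-copy-≤2 i c a = dist-≤ (step (copy-hub i c) (step (hub-copy i a) (here _)))

  2≤dist-copy-outside : ∀ {i y} c → block y ≢ i → 2 ≤ dist (copy i c) y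
  2≤dist-copy-outside c y∉i = 2≤dist (outside-block-≢ y∉i) (copy-¬adj-outside c y∉i)

  3≤dist-between-copies : ∀ {i i′} c b → i ≢ i′ → 3 ≤ dist (copy i c) (copy i′ b)
  3≤dist-between-copies c b i≢i′ =
    subst (3 ≤_) (sym (dist-via-hub b (≢-block (Fin.suc c) i≢i′)))
                 (s≤s (2≤dist-copy-outside c (≢-block Fin.zero (i≢i′ ∘ sym))))

  hops : Bool → ℕ
  hops true  = 1
  hops false = 2

  hops-injective : ∀ {x y} → hops x ≡ hops y → x ≡ y
  hops-injective {true}  {true}  _ = refl
  hops-injective {false} {false} _ = refl

  dist-within-copy : ∀ i {c a} → c ≢ a → dist (copy i c) (copy i a) ≡ hops (H c a)
  dist-within-copy i {c} {a} c≢a with H c a in ca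
  ... | true  = dist-adj (c≢a ∘ copy-injective) (trans (copy-copy i c a) ca)
  ... | false = ≤-antisym (dist-within-copy-≤2 i c a)
                          (2≤dist (c≢a ∘ copy-injective) (not-¬ (trans (copy-copy i c a) ca)))

  dist-within-copy≢⇔distinguishes : ∀ i {c a b} → c ≢ a → c ≢ b →
    (dist (copy i c) (copy i a) ≢ dist (copy i c) (copy i b)) ⇔ Distinguishes H c a b
  dist-within-copy≢⇔distinguishes i {c} {a} {b} c≢a c≢b = mk⇔
    (λ d≢ → from (λ ca≡cb → d≢ (dist≡ ca≡cb)))
    (λ c-distinguishes d≡ → to c-distinguishes (hops-injective (trans (sym (dist-within-copy i c≢a))
                                                      (trans d≡ (dist-within-copy i c≢b)))))
    where
    open Equivalence (distinguishes⇔≢ {G = H} {c} {a} {b})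
    dist≡ : H c a ≡ H c b → dist (copy i c) (copy i a) ≡ dist (copy i c) (copy i b)
    dist≡ ca≡cb = trans (dist-within-copy i c≢a) (trans (cong hops ca≡cb) (sym (dist-within-copy i c≢b)))

  copy-distinguishes⇔ : ∀ i {c a b} → Distinguishes K (copy i c) (copy i a) (copy i b) ⇔ Distinguishes H c a b
  copy-distinguishes⇔ i {c} {a} {b} = mk⇔
    (λ d → DH.from λ ca≡cb → DK.to d (trans (copy-copy i c a) (trans ca≡cb (sym (copy-copy i c b)))))
    (λ d → DK.from λ eq → DH.to d (trans (sym (copy-copy i c a)) (trans eq (copy-copy i c b))))
    where
    module DH = Equivalence (distinguishes⇔≢ {G = H} {c} {a} {b})
    module DK = Equivalence (distinguishes⇔≢ {G = K} {copy i c} {copy i a} {copy i b})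

  ⊙ˢ-member : Subset n → Subset h → Fin n × Fin (suc h) → Bool
  ⊙ˢ-member D S (i , Fin.zero)  = lookup D i
  ⊙ˢ-member D S (i , Fin.suc c) = lookup S c

  infixr 6 _⊙ˢ_

  _⊙ˢ_ : Subset n → Subset h → Subset (n * suc h)
  D ⊙ˢ S = tabulate λ x → ⊙ˢ-member D S (remQuot (suc h) x)

  restrict : Subset (n * suc h) → Fin n → Subset h
  restrict T i = tabulate λ c → lookup T (copy i c)

  lookup-⊙ˢ : ∀ D S i j → lookup (D ⊙ˢ S) (combine i j) ≡ ⊙ˢ-member D S (i , j)
  lookup-⊙ˢ D S i j = trans (lookup∘tabulate _ (combine i j)) (cong (⊙ˢ-member D S) (remQuot-combine i j))

  hub∈⊙ˢ : ∀ {D S i} → i ∈ D → hub i ∈ D ⊙ˢ S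
  hub∈⊙ˢ {D} {S} {i} i∈D = lookup⇒[]= (hub i) (D ⊙ˢ S) (trans (lookup-⊙ˢ D S i Fin.zero) ([]=⇒lookup i∈D))

  copy∈⊙ˢ : ∀ {D S i c} → c ∈ S → copy i c ∈ D ⊙ˢ S
  copy∈⊙ˢ {D} {S} {i} {c} c∈S = lookup⇒[]= (copy i c) (D ⊙ˢ S) (trans (lookup-⊙ˢ D S i (Fin.suc c)) ([]=⇒lookup c∈S))

  copy∉⊙ˢ : ∀ {D S i c} → copy i c ∉ D ⊙ˢ S → c ∉ S
  copy∉⊙ˢ copy∉ = copy∉ ∘ copy∈⊙ˢ

  restrict-⊙ˢ : ∀ D S i → restrict (D ⊙ˢ S) i ≡ S
  restrict-⊙ˢ D S i = trans (tabulate-cong (λ c → lookup-⊙ˢ D S i (Fin.suc c))) (tabulate∘lookup S)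

  copy∈⇒∈restrict : ∀ {T i c} → copy i c ∈ T → c ∈ restrict T i
  copy∈⇒∈restrict {T} {i} {c} copy∈T = lookup⇒[]= c (restrict T i) (trans (lookup∘tabulate _ c) ([]=⇒lookup copy∈T))

  copy∉restrict : ∀ {T i c} → c ∉ restrict T i → copy i c ∉ T
  copy∉restrict c∉ = c∉ ∘ copy∈⇒∈restrict

  block-size : Subset (n * suc h) → Fin n → ℕ
  block-size T i = indicator (lookup T (hub i)) + ∣ restrict T i ∣

  ∣T∣≡∑block-size : ∀ T → ∣ T ∣ ≡ ∑[ i < n ] block-size T i
  ∣T∣≡∑block-size T = begin
    ∣ T ∣                                                        ≡⟨ ∣p∣≡∑ T ⟩
    sum (indicator ∘ lookup T)                                   ≡⟨ ∑-combine n (suc h) _ ⟩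
    ∑[ i < n ] ∑[ j < suc h ] indicator (lookup T (combine i j)) ≡⟨ sum-cong-≗ ∣block∣ ⟨
    ∑[ i < n ] block-size T i                                    ∎
    where
    open ≡-Reasoning
    ∣block∣ : ∀ i → block-size T i ≡ ∑[ j < suc h ] indicator (lookup T (combine i j))
    ∣block∣ i = cong (indicator (lookup T (hub i)) +_) (trans (∣p∣≡∑ (restrict T i))
                  (sum-cong-≗ λ c → cong indicator (lookup∘tabulate (λ c → lookup T (copy i c)) c)))

  ∣⊙ˢ∣ : ∀ D S → ∣ D ⊙ˢ S ∣ ≡ ∣ D ∣ + n * ∣ S ∣
  ∣⊙ˢ∣ D S = begin
    ∣ D ⊙ˢ S ∣                                          ≡⟨ ∣T∣≡∑block-size (D ⊙ˢ S) ⟩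
    ∑[ i < n ] block-size (D ⊙ˢ S) i                    ≡⟨ sum-cong-≗ block-size-⊙ˢ ⟩
    ∑[ i < n ] (indicator (lookup D i) + ∣ S ∣)         ≡⟨ ∑-distrib-+ (indicator ∘ lookup D) (λ _ → ∣ S ∣) ⟩
    ∑[ i < n ] indicator (lookup D i) + ∑[ i < n ] ∣ S ∣ ≡⟨ cong₂ _+_ (sym (∣p∣≡∑ D)) (∑-const n ∣ S ∣) ⟩
    ∣ D ∣ + n * ∣ S ∣                                    ∎
    where
    open ≡-Reasoning
    block-size-⊙ˢ : ∀ i → block-size (D ⊙ˢ S) i ≡ indicator (lookup D i) + ∣ S ∣
    block-size-⊙ˢ i = cong₂ _+_ (cong indicator (lookup-⊙ˢ D S i Fin.zero)) (cong ∣_∣ (restrict-⊙ˢ D S i))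

  ⊙-pair-cases : {P : Fin (n * suc h) → Fin (n * suc h) → Set} → (∀ {x y} → P x y → P y x) →
    (∀ i {a b} → a ≢ b → P (copy i a) (copy i b)) →
    (∀ i b → P (hub i) (copy i b)) →
    (∀ {i i′} a b → i ≢ i′ → P (copy i a) (copy i′ b)) →
    (∀ i {y} → block y ≢ i → P (hub i) y) →
    ∀ x y → x ≢ y → P x y
  ⊙-pair-cases {P} P-sym same-copy own-copy other-copies hub-outside x y = cases (view x) (view y)
    where
    from-hub : ∀ i y → hub i ≢ y → P (hub i) y
    from-hub i y hub≢y with block y Fin.≟ i
    ... | no  y∉i = hub-outside i y∉i
    ... | yes y∈i with block-members y∈i
    ...   | inj₁ refl       = contradiction refl hub≢y
    ...   | inj₂ (b , refl) = own-copy i b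

    cases : ∀ {x y} → View x → View y → x ≢ y → P x y
    cases {y = y} (hubᵛ i) _ x≢y = from-hub i y x≢y
    cases (copyᵛ i a) (hubᵛ i′) x≢y = P-sym (from-hub i′ _ (x≢y ∘ sym))
    cases (copyᵛ i a) (copyᵛ i′ b) x≢y with i Fin.≟ i′
    ... | yes refl = same-copy i (x≢y ∘ cong (copy i))
    ... | no i≢i′  = other-copies a b i≢i′

  Resolves : Subset (n * suc h) → Fin (n * suc h) → Fin (n * suc h) → Set
  Resolves T x y = ∃ λ s → s ∈ T × dist s x ≢ dist s y

  resolves-sym : ∀ {T x y} → Resolves T x y → Resolves T y x
  resolves-sym (s , s∈T , d≢) = s , s∈T , d≢ ∘ sym

  resolving⇒metric-generator : ∀ {T} → (∀ x y → x ≢ y → Resolves T x y) → IsMetricGenerator K T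
  resolving⇒metric-generator resolves x y x≢y with resolves x y x≢y
  ... | s , s∈T , d≢ = s , s∈T , _ , _ , dist-IsDist s x , dist-IsDist s y , d≢

  resolving-outside⇒resolving : ∀ {T} → (∀ x y → x ≢ y → x ∉ T → y ∉ T → Resolves T x y) →
                                ∀ x y → x ≢ y → Resolves T x y
  resolving-outside⇒resolving {T} resolves x y x≢y with x ∈? T | y ∈? T
  ... | yes x∈T | _       = x , x∈T , λ d≡ → x≢y (dist≡0⇒≡ (trans (sym d≡) (dist-refl x)))
  ... | no _    | yes y∈T = y , y∈T , λ d≡ → x≢y (sym (dist≡0⇒≡ (trans d≡ (dist-refl y))))
  ... | no x∉T  | no y∉T  = resolves x y x≢y x∉T y∉T

  copies-metric-generator : ∀ {S} → 2 ≤ n → IsAdjGenerator H S → Nonempty S → IsMetricGenerator K (⊥ ⊙ˢ S)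
  copies-metric-generator {S} 2≤n S-generates (s₀ , s₀∈S) =
    resolving⇒metric-generator (resolving-outside⇒resolving
      (⊙-pair-cases (λ r y∉T x∉T → resolves-sym (r x∉T y∉T)) same-copy own-copy other-copies hub-outside))
    where
    T = ⊥ ⊙ˢ S

    same-copy : ∀ i {a b} → a ≢ b → copy i a ∉ T → copy i b ∉ T → Resolves T (copy i a) (copy i b)
    same-copy i a≢b a∉T b∉T with S-generates _ _ a≢b (copy∉⊙ˢ a∉T) (copy∉⊙ˢ b∉T)
    ... | c , c∈S , c-distinguishes =
      copy i c , copy∈⊙ˢ c∈S ,
      Equivalence.from (dist-within-copy≢⇔distinguishes i (∈∧∉⇒≢ c∈S (copy∉⊙ˢ a∉T)) (∈∧∉⇒≢ c∈S (copy∉⊙ˢ b∉T)))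
                       c-distinguishes

    own-copy : ∀ i b → hub i ∉ T → copy i b ∉ T → Resolves T (hub i) (copy i b)
    own-copy i b _ _ with other-vertex 2≤n i
    ... | j , j≢i = copy j s₀ , copy∈⊙ˢ s₀∈S ,
                    λ d≡ → 1+n≢n (sym (trans d≡ (dist-via-hub b (≢-block (Fin.suc s₀) j≢i))))

    other-copies : ∀ {i i′} a b → i ≢ i′ → copy i a ∉ T → copy i′ b ∉ T → Resolves T (copy i a) (copy i′ b)
    other-copies {i} a b i≢i′ _ _ = copy i s₀ , copy∈⊙ˢ s₀∈S , λ d≡ →
      1+n≰n (≤-trans (3≤dist-between-copies s₀ b i≢i′) (subst (_≤ 2) d≡ (dist-within-copy-≤2 i s₀ a)))

    hub-outside : ∀ i {y} → block y ≢ i → hub i ∉ T → y ∉ T → Resolves T (hub i) y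
    hub-outside i y∉i _ _ = copy i s₀ , copy∈⊙ˢ s₀∈S , λ d≡ →
      1+n≰n (≤-trans (2≤dist-copy-outside s₀ y∉i) (≤-reflexive (trans (sym d≡) (dist-copy-hub i s₀))))

  Separates : Subset (n * suc h) → Fin (n * suc h) → Fin (n * suc h) → Set
  Separates T x y = ∃ λ s → s ∈ T × Distinguishes K s x y

  separates-sym : ∀ {T x y} → Separates T x y → Separates T y x
  separates-sym (s , s∈T , s-distinguishes) = s , s∈T , distinguishes-sym {G = K} s-distinguishes

  ⊙ˢ-adjacency-generator : ∀ D {S} → IsAdjGenerator H S → Nonempty S →
    (∀ {i i′} a b → i ≢ i′ → a ∉ S → b ∉ S → Separates (D ⊙ˢ S) (copy i a) (copy i′ b)) →
    (∀ i b → i ∉ D → b ∉ S → Separates (D ⊙ˢ S) (hub i) (copy i b)) →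
    IsAdjGenerator K (D ⊙ˢ S)
  ⊙ˢ-adjacency-generator D {S} S-generates (s₀ , s₀∈S) separate-copies separate-hub-copy =
    ⊙-pair-cases (λ r y∉T x∉T → separates-sym (r x∉T y∉T)) same-copy own-copy other-copies hub-outside
    where
    T = D ⊙ˢ S

    same-copy : ∀ i {a b} → a ≢ b → copy i a ∉ T → copy i b ∉ T → Separates T (copy i a) (copy i b)
    same-copy i a≢b a∉T b∉T with S-generates _ _ a≢b (copy∉⊙ˢ a∉T) (copy∉⊙ˢ b∉T)
    ... | c , c∈S , c-distinguishes = copy i c , copy∈⊙ˢ c∈S , Equivalence.from (copy-distinguishes⇔ i) c-distinguishes

    own-copy : ∀ i b → hub i ∉ T → copy i b ∉ T → Separates T (hub i) (copy i b)
    own-copy i b hub∉T b∉T = separate-hub-copy i b (hub∉T ∘ hub∈⊙ˢ) (copy∉⊙ˢ b∉T)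

    other-copies : ∀ {i i′} a b → i ≢ i′ → copy i a ∉ T → copy i′ b ∉ T → Separates T (copy i a) (copy i′ b)
    other-copies a b i≢i′ a∉T b∉T = separate-copies a b i≢i′ (copy∉⊙ˢ a∉T) (copy∉⊙ˢ b∉T)

    hub-outside : ∀ i {y} → block y ≢ i → hub i ∉ T → y ∉ T → Separates T (hub i) y
    hub-outside i y∉i _ _ = copy i s₀ , copy∈⊙ˢ s₀∈S , inj₁ (copy-hub i s₀ , copy-¬adj-outside s₀ y∉i)

  all-hubs-but-one-adjacency-generator : ∀ {u w S} → Adj G w u → IsAdjGenerator H S → Nonempty S →
                                          IsAdjGenerator K (∁ ⁅ u ⁆ ⊙ˢ S)
  all-hubs-but-one-adjacency-generator {u} {w} {S} wu S-generates S-nonempty =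
    ⊙ˢ-adjacency-generator (∁ ⁅ u ⁆) S-generates S-nonempty other-copies own-copy
    where
    hub∈ : ∀ {i} → i ≢ u → hub i ∈ ∁ ⁅ u ⁆ ⊙ˢ S
    hub∈ i≢u = hub∈⊙ˢ (x∉p⇒x∈∁p (x≢y⇒x∉⁅y⁆ i≢u))

    other-copies : ∀ {i i′} a b → i ≢ i′ → a ∉ S → b ∉ S → Separates (∁ ⁅ u ⁆ ⊙ˢ S) (copy i a) (copy i′ b)
    other-copies {i} {i′} a b i≢i′ _ _ with i Fin.≟ u
    ... | no  i≢u  = hub i , hub∈ i≢u , inj₁ (hub-copy i a , hub-¬adj-other-copy b i≢i′)
    ... | yes refl = hub i′ , hub∈ (i≢i′ ∘ sym) , inj₂ (hub-¬adj-other-copy a (i≢i′ ∘ sym) , hub-copy i′ b)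

    own-copy : ∀ i b → i ∉ ∁ ⁅ u ⁆ → b ∉ S → Separates (∁ ⁅ u ⁆ ⊙ˢ S) (hub i) (copy i b)
    own-copy i b i∉D _ with refl ← x∈⁅y⁆⇒x≡y u (x∉∁p⇒x∈p i∉D) =
      hub w , hub∈ w≢u , inj₁ (trans (hub-hub w u) wu , hub-¬adj-other-copy b w≢u)
      where w≢u = Adj⇒≢ G-simple wu

  -- Domination gives every vertex outside S a neighbour in S, which separates it from all other
  -- copies; hubs are then only needed against the own copy, and v_centre serves both leaves.
  all-hubs-but-two-adjacency-generator : ∀ (cherry : Cherry G) {S} → let open Cherry cherry in
    IsAdjGenerator H S → IsDominating H S → Nonempty S → IsAdjGenerator K ((∁ ⁅ leaf₁ ⁆ - leaf₂) ⊙ˢ S)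
  all-hubs-but-two-adjacency-generator cherry {S} S-generates S-dominates S-nonempty =
    ⊙ˢ-adjacency-generator D S-generates S-nonempty other-copies own-copy
    where
    open Cherry cherry
    D = ∁ ⁅ leaf₁ ⁆ - leaf₂

    leaf : ∀ {i} → i ∉ D → i ≡ leaf₁ ⊎ i ≡ leaf₂
    leaf {i} i∉D with i Fin.≟ leaf₂
    ... | yes i≡leaf₂ = inj₂ i≡leaf₂
    ... | no  i≢leaf₂ = inj₁ (x∈⁅y⁆⇒x≡y leaf₁ (x∉∁p⇒x∈p λ i∈∁ → i∉D (x∈p∧x≢y⇒x∈p-y i∈∁ i≢leaf₂)))

    centre-leaf : ∀ {i} → i ≡ leaf₁ ⊎ i ≡ leaf₂ → Adj G centre i
    centre-leaf (inj₁ refl) = centre-leaf₁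
    centre-leaf (inj₂ refl) = centre-leaf₂

    centre∈D : centre ∈ D
    centre∈D = x∈p∧x≢y⇒x∈p-y (x∉p⇒x∈∁p (x≢y⇒x∉⁅y⁆ (Adj⇒≢ G-simple centre-leaf₁))) (Adj⇒≢ G-simple centre-leaf₂)

    other-copies : ∀ {i i′} a b → i ≢ i′ → a ∉ S → b ∉ S → Separates (D ⊙ˢ S) (copy i a) (copy i′ b)
    other-copies {i} a b i≢i′ a∉S _ with S-dominates a
    ... | inj₁ a∈S = contradiction a∈S a∉S
    ... | inj₂ (c , c∈S , ca) = copy i c , copy∈⊙ˢ c∈S ,
                                 inj₁ (trans (copy-copy i c a) ca , copy-¬adj-outside c (≢-block (Fin.suc b) (i≢i′ ∘ sym)))

    own-copy : ∀ i b → i ∉ D → b ∉ S → Separates (D ⊙ˢ S) (hub i) (copy i b)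
    own-copy i b i∉D _ = hub centre , hub∈⊙ˢ centre∈D ,
      inj₁ (trans (hub-hub centre i) (centre-leaf (leaf i∉D)) , hub-¬adj-other-copy b (Adj⇒≢ G-simple (centre-leaf (leaf i∉D))))

  restrict-metric-generator : ∀ {M} → IsMetricGenerator K M → ∀ i → IsAdjGenerator H (restrict M i)
  restrict-metric-generator {M} M-generates i a b a≢b a∉ b∉
    with M-generates (copy i a) (copy i b) (a≢b ∘ copy-injective)
  ... | s , s∈M , _ , _ , d₁ , d₂ , k₁≢k₂ =
    resolver-in-copy s∈M λ eq → k₁≢k₂ (trans (IsDist⇒≡dist d₁) (trans eq (sym (IsDist⇒≡dist d₂))))
    where
    resolver-in-copy : ∀ {s} → s ∈ M → dist s (copy i a) ≢ dist s (copy i b) →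
                       ∃ λ c → c ∈ restrict M i × Distinguishes H c a b
    resolver-in-copy {s} s∈M d≢ with block s Fin.≟ i
    ... | no  s∉i = contradiction (trans (dist-via-hub a s∉i) (sym (dist-via-hub b s∉i))) d≢
    ... | yes s∈i with block-members s∈i
    ...   | inj₁ refl       = contradiction (trans (dist-hub-copy i a) (sym (dist-hub-copy i b))) d≢
    ...   | inj₂ (c , refl) = let c∈ = copy∈⇒∈restrict s∈M in
      c , c∈ , Equivalence.to (dist-within-copy≢⇔distinguishes i (∈∧∉⇒≢ c∈ a∉) (∈∧∉⇒≢ c∈ b∉)) d≢

  restrict-adjacency-generator : ∀ {T} → IsAdjGenerator K T → ∀ i → IsAdjGenerator H (restrict T i)
  restrict-adjacency-generator {T} T-generates i a b a≢b a∉ b∉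
    with T-generates (copy i a) (copy i b) (a≢b ∘ copy-injective) (copy∉restrict a∉) (copy∉restrict b∉)
  ... | s , s∈T , s-distinguishes with block s Fin.≟ i
  ...   | no  s∉i = contradiction (distinguishes⇒adj {G = K} s-distinguishes)
                                  [ outside-¬adj-copy a s∉i , outside-¬adj-copy b s∉i ]′
  ...   | yes s∈i with block-members s∈i
  ...     | inj₁ refl       = contradiction (trans (hub-copy i a) (sym (hub-copy i b)))
                                            (Equivalence.to (distinguishes⇔≢ {G = K}) s-distinguishes)
  ...     | inj₂ (c , refl) = c , copy∈⇒∈restrict s∈T , Equivalence.to (copy-distinguishes⇔ i) s-distinguishes

  block-size-≥ : ∀ {a T} → IsAdjDim H a → (∀ i → IsAdjGenerator H (restrict T i)) → ∀ i → a ≤ block-size T i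
  block-size-≥ (_ , minimal) restricted i = ≤-trans (minimal _ (restricted i)) (m≤n+m _ _)

  metric-generator-size : ∀ {a M} → IsAdjDim H a → IsMetricGenerator K M → n * a ≤ ∣ M ∣
  metric-generator-size {a} {M} dimA M-generates = begin
    n * a                      ≡⟨ ∑-const n a ⟨
    ∑[ i < n ] a               ≤⟨ ∑-mono-≤ (block-size-≥ {T = M} dimA (restrict-metric-generator M-generates)) ⟩
    ∑[ i < n ] block-size M i  ≡⟨ ∣T∣≡∑block-size M ⟨
    ∣ M ∣                      ∎
    where open ≤-Reasoning

  thin-block : ∀ {a T i} → IsAdjDim H a → IsAdjGenerator K T → block-size T i ≤ a →
               hub i ∉ T × IsAdjBasis H (restrict T i)
  thin-block {a} {T} {i} dimA T-generates thin =
    hub∉T , small-adj-generator-is-basis dimA restricted (≤-trans (m≤n+m _ _) thin)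
    where
    restricted = restrict-adjacency-generator T-generates i
    hub∉T : hub i ∉ T
    hub∉T hub∈T = 1+n≰n (begin
      suc a                                     ≤⟨ s≤s (proj₂ dimA _ restricted) ⟩
      suc ∣ restrict T i ∣                       ≡⟨ cong (_+ ∣ restrict T i ∣) (x∈p⇒indicator≡1 hub∈T) ⟨
      block-size T i                            ≤⟨ thin ⟩
      a                                         ∎)
      where open ≤-Reasoning

  thin-block-isolated-vertex : ∀ {a T i} → IsAdjDim H a →
    (¬ HasDominatingAdjBasis H) → IsAdjGenerator K T → block-size T i ≤ a →
    ∃ λ u → copy i u ∉ T × (∀ {s} → s ∈ T → ¬ Adj K s (copy i u))
  thin-block-isolated-vertex {T = T} {i} dimA no-dominating-basis T-generates thin
    with thin-block dimA T-generates thin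
  ... | hub∉T , basis with undominated-vertex (λ dominates → no-dominating-basis (_ , basis , dominates))
  ...   | u , u∉ , undominated = u , copy∉restrict u∉ , isolated
    where
    isolated : ∀ {s} → s ∈ T → ¬ Adj K s (copy i u)
    isolated {s} s∈T with block s Fin.≟ i
    ... | no  s∉i = outside-¬adj-copy u s∉i
    ... | yes s∈i with block-members s∈i
    ...   | inj₁ refl       = contradiction s∈T hub∉T
    ...   | inj₂ (c , refl) = undominated c (copy∈⇒∈restrict s∈T) ∘ trans (sym (copy-copy i c u))

  adjacency-generator-size : ∀ {a T} → IsAdjDim H a → (¬ HasDominatingAdjBasis H) →
                             IsAdjGenerator K T → n * a + (n ∸ 1) ≤ ∣ T ∣
  adjacency-generator-size {a} {T} dimA no-dominating-basis T-generates =
    subst (n * a + (n ∸ 1) ≤_) (sym (∣T∣≡∑block-size T))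
          (∑-≥-all-but-one a (block-size T) (block-size-≥ {T = T} dimA (restrict-adjacency-generator T-generates))
                           at-most-one-thin)
    where
    at-most-one-thin : ∀ i j → block-size T i ≤ a → block-size T j ≤ a → i ≡ j
    at-most-one-thin i j thin-i thin-j with i Fin.≟ j
    ... | yes i≡j = i≡j
    ... | no  i≢j with thin-block-isolated-vertex dimA no-dominating-basis T-generates thin-i
                     | thin-block-isolated-vertex dimA no-dominating-basis T-generates thin-j
    ...   | u , u∉T , u-isolated | v , v∉T , v-isolated
      with T-generates (copy i u) (copy j v) (outside-block-≢ (≢-block (Fin.suc v) (i≢j ∘ sym))) u∉T v∉T
    ...     | s , s∈T , s-distinguishes =
      contradiction (distinguishes⇒adj {G = K} s-distinguishes) [ u-isolated s∈T , v-isolated s∈T ]′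

  metric-dimension : ∀ {a m} → 2 ≤ n → 2 ≤ h → IsAdjDim H a → IsMetricDim K m → m ≡ n * a
  metric-dimension {a} {m} 2≤n 2≤h dimA@((B , B-generates , ∣B∣≡a) , _) ((M , M-generates , ∣M∣≡m) , minimal) =
    ≤-antisym (begin
      m                  ≤⟨ minimal _ (copies-metric-generator 2≤n B-generates (adjacency-generator-nonempty 2≤h B-generates)) ⟩
      ∣ ⊥ ⊙ˢ B ∣         ≡⟨ ∣⊙ˢ∣ ⊥ B ⟩
      ∣ ⊥ {n = n} ∣ + n * ∣ B ∣ ≡⟨ cong₂ _+_ (∣⊥∣≡0 n) (cong (n *_) ∣B∣≡a) ⟩
      n * a              ∎)
      (≤-trans (metric-generator-size dimA M-generates) (≤-reflexive ∣M∣≡m))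
    where open ≤-Reasoning

  adjacency-dimension-≤ : ∀ {a b u w} → Adj G w u → 2 ≤ h → IsAdjDim H a → IsAdjDim K b → b ≤ n * a + (n ∸ 1)
  adjacency-dimension-≤ {a} {b} {u} wu 2≤h ((B , B-generates , ∣B∣≡a) , _) (_ , minimal) = begin
    b                              ≤⟨ minimal _ (all-hubs-but-one-adjacency-generator wu B-generates
                                                  (adjacency-generator-nonempty 2≤h B-generates)) ⟩
    ∣ ∁ ⁅ u ⁆ ⊙ˢ B ∣               ≡⟨ ∣⊙ˢ∣ (∁ ⁅ u ⁆) B ⟩
    ∣ ∁ ⁅ u ⁆ ∣ + n * ∣ B ∣         ≡⟨ cong₂ _+_ (∣∁⁅x⁆∣≡n∸1 u) (cong (n *_) ∣B∣≡a) ⟩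
    (n ∸ 1) + n * a                ≡⟨ +-comm (n ∸ 1) (n * a) ⟩
    n * a + (n ∸ 1)                ∎
    where open ≤-Reasoning

  adjacency-dimension-≥ : ∀ {a b} → IsAdjDim H a → IsAdjDim K b →
    (¬ HasDominatingAdjBasis H) → n * a + (n ∸ 1) ≤ b
  adjacency-dimension-≥ dimA ((T , T-generates , ∣T∣≡b) , _) no-dominating-basis =
    ≤-trans (adjacency-generator-size dimA no-dominating-basis T-generates) (≤-reflexive ∣T∣≡b)

  adjacency-dimension-< : ∀ {a b} → Cherry G → 2 ≤ h → IsAdjDim H a → IsAdjDim K b →
    HasDominatingAdjBasis H → b < n * a + (n ∸ 1)
  adjacency-dimension-< {a} {b} cherry 2≤h dimA (_ , minimal) (S , S-basis@(S-generates , _) , S-dominates) = begin-strict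
    b                                ≤⟨ minimal _ (all-hubs-but-two-adjacency-generator cherry S-generates S-dominates
                                                    (adjacency-generator-nonempty 2≤h S-generates)) ⟩
    ∣ D ⊙ˢ S ∣                       ≡⟨ ∣⊙ˢ∣ D S ⟩
    ∣ D ∣ + n * ∣ S ∣                <⟨ +-monoˡ-< (n * ∣ S ∣) (x∈p⇒∣p-x∣<∣p∣ leaf₂∈∁) ⟩
    ∣ ∁ ⁅ leaf₁ ⁆ ∣ + n * ∣ S ∣      ≡⟨ cong₂ _+_ (∣∁⁅x⁆∣≡n∸1 leaf₁) (cong (n *_) (adj-basis-size dimA S-basis)) ⟩
    (n ∸ 1) + n * a                  ≡⟨ +-comm (n ∸ 1) (n * a) ⟩
    n * a + (n ∸ 1)                  ∎
    where
    open ≤-Reasoning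
    open Cherry cherry
    D = ∁ ⁅ leaf₁ ⁆ - leaf₂
    leaf₂∈∁ : leaf₂ ∈ ∁ ⁅ leaf₁ ⁆
    leaf₂∈∁ = x∉p⇒x∈∁p (x≢y⇒x∉⁅y⁆ (leaf₁≢leaf₂ ∘ sym))

theorem16 : ∀ {n h} (G : Graph n) (H : Graph h) →
    IsSimple G → IsSimple H → Connected G → 3 ≤ n → 2 ≤ h →
    ∀ (a b m : ℕ) → IsAdjDim H a → IsAdjDim (G ⊙ H) b → IsMetricDim (G ⊙ H) m →
    ((¬ HasDominatingAdjBasis H) ⇔ (b ≡ n * a + (n ∸ 1)))
    × ((b ≡ n * a + (n ∸ 1)) ⇔ (b ≡ m + (n ∸ 1)))
theorem16 {n} G H G-simple _ G-connected 3≤n 2≤h a b m dimA-H dimA-G⊙H dim-G⊙H =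
  mk⇔ (λ no-dominating-basis → ≤-antisym (adjacency-dimension-≤ centre-leaf₁ 2≤h dimA-H dimA-G⊙H)
                                          (adjacency-dimension-≥ dimA-H dimA-G⊙H no-dominating-basis))
      (λ b≡ dominating-basis → <-irrefl b≡ (adjacency-dimension-< G-cherry 2≤h dimA-H dimA-G⊙H dominating-basis))
  , mk⇔ (λ b≡ → trans b≡ (cong (_+ (n ∸ 1)) (sym m≡n*a))) (λ b≡ → trans b≡ (cong (_+ (n ∸ 1)) m≡n*a))
  where
  open Corona G H G-simple G-connected
  G-cherry = cherry G G-simple G-connected 3≤n
  open Cherry G-cherry using (centre-leaf₁)
  m≡n*a : m ≡ n * a
  m≡n*a = metric-dimension (≤-trans (n≤1+n 2) 3≤n) 2≤h dimA-H dim-G⊙H
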